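{- Let $\phi : H \rightarrow G$ be a complete graph homomorphism between finite graphs, let $n$ be a positive integer, and fix an identification of $V(G)$ with $\{1,\dots,|V(G)|\}$. Then $\chi(H) \leq n$ if and only if there exists a $(G,n,\mathcal F_{G,\phi})$-independent system (with respect to this identification).
   Context: Graphs are simple; $N(v)$ denotes the set of neighbours of $v$, and $\phi(X)=\{\phi(x):x\in X\}$. A homomorphism $\phi:H\to G$ is complete if for any $x,z\in V(H)$ with $\phi(z)\in\phi(N(x))$ and $\phi(x)\in\phi(N(z))$ we have $(x,z)\in E(H)$. $\mathcal F_{G,\phi} = \{(\phi(v), \phi(N(v))) : v \in V(H)\}$. For $G$ with vertices identified with $\{1,\dots,|V(G)|\}$, a positive integer $n$, and a collection $\mathcal F_G$ of pairs $(v,S)$ with $v\in V(G)$ and $S$ a set of neighbours of $v$, a family $\{A_{u,v}\}$ indexed by edges $(u,v)\in E(G)$ with $u<v$, each $A_{u,v}\subseteq[n]$, is $(G,n,\mathcal F_G)$-independent if for every $(v,S)\in\mathcal F_G$: if $v>\min S$ then $\bigcap_{u\in S,\,u<v}A_{u,v}\setminus\bigcup_{w\in S,\,w>v}A_{v,w}\neq\emptyset$, and if $v<\min S$ (or $S=\emptyset$) then $[n]\setminus\bigcup_{w\in S,\,w>v}A_{v,w}\neq\emptyset$. -}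

module Defs where

open import Data.Nat using (ℕ)
open import Data.Fin using (Fin; _<_)
open import Data.Fin.Subset using (Subset; _∈_; _∉_)
open import Data.Product using (Σ; ∃; ∃-syntax; _×_)
open import Relation.Nullary using (¬_; Dec)
open import Relation.Binary.PropositionalEquality using (_≡_; _≢_)

-- The vertex set of a graph
-- on m vertices is thus identified with {1,…,m} (Fin m = {0,…,m-1}, with the
-- order of Data.Fin), which is the fixed identification of the statement.
record Graph : Set₁ where
  field
    size   : ℕ
    Adj    : Fin size → Fin size → Set
    Adj?   : (x y : Fin size) → Dec (Adj x y)
    sym    : ∀ {x y} → Adj x y → Adj y x
    irrefl : ∀ {x} → ¬ Adj x x
open Graph public

V : Graph → Set
V G = Fin (size G)

IsHom : (H G : Graph) → (V H → V G) → Set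
IsHom H G φ = ∀ x y → Adj H x y → Adj G (φ x) (φ y)

InImageNbhd : (H G : Graph) → (V H → V G) → V H → V G → Set
InImageNbhd H G φ x u = ∃[ y ] (Adj H x y × φ y ≡ u)

IsComplete : (H G : Graph) → (V H → V G) → Set
IsComplete H G φ = ∀ x z →
  InImageNbhd H G φ x (φ z) → InImageNbhd H G φ z (φ x) → Adj H x z

Colourable : Graph → ℕ → Set
Colourable H n = Σ (V H → Fin n) λ c → ∀ (x y : V H) → Adj H x y → c x ≢ c y

-- A family {A_{u,v}} of subsets of [n] (= Fin n).  It is given as a function on
-- all pairs (u , v); only the values on edges (u , v) with u < v are ever used.
Family : Graph → ℕ → Set
Family G n = V G → V G → Subset n

-- (G, n, F_{G,φ})-independence.  The pairs of F_{G,φ} are (φ x , φ(N x)) for x in V(H).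
Independent : (H G : Graph) (φ : V H → V G) (n : ℕ) → Family G n → Set
Independent H G φ n A = ∀ (x : V H) → Cond (φ x) (InImageNbhd H G φ x)
  where
  Cond : V G → (V G → Set) → Set
  Cond v S =
    ((∃[ u ] (S u × u < v)) →
       ∃[ i ] ((∀ u → S u → u < v → i ∈ A u v) × (∀ w → S w → v < w → i ∉ A v w)))
    ×
    ((∀ u → S u → v < u) →
       ∃[ i ] (∀ w → S w → v < w → i ∉ A v w))

-- A colouring c yields the family A u v = { c z : φ z = v and u ∈ φ(N z) }.  Each
-- vertex x has c x in every A u (φ x) with u ∈ φ(N x), and by completeness c x lies
-- in no A (φ x) w with w ∈ φ(N x), since otherwise x would be adjacent to a vertex
-- of the same colour.  Conversely, an independent system lets us colour x by a
-- witness of its condition; for an edge x z with φ x < φ z the colour of z lies in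
-- A (φ x) (φ z) while the colour of x does not, so the two colours differ.
module Submission where

open import Defs
open import Data.Nat using (ℕ; _≥_)
open import Data.Bool.Properties using (T-≡)
open import Data.Product using (_×_; ∃; ∃-syntax; _,_; proj₁; proj₂)
open import Data.Fin using (Fin; _<_; _<?_)
open import Data.Fin.Properties using (any?; <-cmp) renaming (_≟_ to _≟ᶠ_)
open import Data.Fin.Subset using (Subset; _∈_; _∉_)
open import Data.Vec using (tabulate)
open import Data.Vec.Properties using (lookup∘tabulate; lookup⇒[]=; []=⇒lookup)
open import Function.Bundles using (_⇔_; mk⇔; Equivalence)
open import Relation.Binary using (tri<; tri≈; tri>)
open import Relation.Binary.PropositionalEquality using (_≡_; _≢_; refl; trans; subst) renaming (sym to ≡-sym)
open import Relation.Nullary using (¬_; Dec; yes; no; contradiction)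
open import Relation.Nullary.Decidable using (⌊_⌋; toWitness; fromWitness; _×-dec_)
open import Relation.Unary using (Pred; Decidable)

subset : ∀ {n p} {P : Pred (Fin n) p} → Decidable P → Subset n
subset P? = tabulate (λ i → ⌊ P? i ⌋)

∈-subset⁺ : ∀ {n p} {P : Pred (Fin n) p} (P? : Decidable P) {i} → P i → i ∈ subset P?
∈-subset⁺ P? {i} Pi =
  lookup⇒[]= i _ (trans (lookup∘tabulate _ i) (Equivalence.to T-≡ (fromWitness {a? = P? i} Pi)))

∈-subset⁻ : ∀ {n p} {P : Pred (Fin n) p} (P? : Decidable P) {i} → i ∈ subset P? → P i
∈-subset⁻ P? {i} i∈ =
  toWitness {a? = P? i} (Equivalence.from T-≡ (trans (≡-sym (lookup∘tabulate _ i)) ([]=⇒lookup i∈)))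

module _ (H G : Graph) (φ : V H → V G) where

  φN : V H → V G → Set
  φN = InImageNbhd H G φ

  φN? : ∀ x u → Dec (φN x u)
  φN? x u = any? (λ y → Adj? H x y ×-dec (φ y ≟ᶠ u))

  hom⇒φ-adjacent-distinct : IsHom H G φ → ∀ {x y} → Adj H x y → φ x ≢ φ y
  hom⇒φ-adjacent-distinct hom {x} {y} xy φx≡φy =
    irrefl G (subst (λ t → Adj G t (φ y)) φx≡φy (hom x y xy))

  hom⇒images-above : IsHom H G φ → ∀ x →
    ¬ (∃[ u ] (φN x u × u < φ x)) → ∀ u → φN x u → φ x < u
  hom⇒images-above hom x noneBelow u (y , xy , refl) with <-cmp (φ x) (φ y)
  ... | tri< φx<φy _ _ = φx<φy
  ... | tri≈ _ φx≡φy _ = contradiction φx≡φy (hom⇒φ-adjacent-distinct hom xy)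
  ... | tri> _ _ φy<φx = contradiction (φ y , (y , xy , refl) , φy<φx) noneBelow

  module _ {n : ℕ} (A : Family G n) where

    -- A colour i separating x witnesses whichever clause of Independent applies at x.
    Separates : V H → Fin n → Set
    Separates x i = (∀ u → φN x u → u < φ x → i ∈ A u (φ x))
                  × (∀ w → φN x w → φ x < w → i ∉ A (φ x) w)

    separating⇒independent : (∀ x → ∃ (Separates x)) → Independent H G φ n A
    separating⇒independent sep x = (λ _ → sep x) , (λ _ → proj₁ (sep x) , proj₂ (proj₂ (sep x)))

    independent⇒separating : IsHom H G φ → Independent H G φ n A → ∀ x → ∃ (Separates x)
    independent⇒separating hom ind x
      with any? (λ u → φN? x u ×-dec (u <? φ x))
    ... | yes someBelow = proj₁ (ind x) someBelow
    ... | no noneBelow =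
      let i , above = proj₂ (ind x) (hom⇒images-above hom x noneBelow)
      in  i , (λ u u∈ u<φx → contradiction (u , u∈ , u<φx) noneBelow) , above

    separating⇒colours-differ-upward : (c : V H → Fin n) → (∀ x → Separates x (c x)) →
      ∀ {x z} → Adj H x z → φ x < φ z → c x ≢ c z
    separating⇒colours-differ-upward c sep {x} {z} xz φx<φz cx≡cz =
      proj₂ (sep x) (φ z) (z , xz , refl) φx<φz
        (subst (_∈ A (φ x) (φ z)) (≡-sym cx≡cz)
          (proj₁ (sep z) (φ x) (x , Graph.sym H xz , refl) φx<φz))

    separating⇒proper : IsHom H G φ → (c : V H → Fin n) → (∀ x → Separates x (c x)) →
      ∀ x z → Adj H x z → c x ≢ c z
    separating⇒proper hom c sep x z xz cx≡cz with <-cmp (φ x) (φ z)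
    ... | tri< φx<φz _ _ = separating⇒colours-differ-upward c sep xz φx<φz cx≡cz
    ... | tri≈ _ φx≡φz _ = hom⇒φ-adjacent-distinct hom xz φx≡φz
    ... | tri> _ _ φz<φx =
      separating⇒colours-differ-upward c sep (Graph.sym H xz) φz<φx (≡-sym cx≡cz)

  module _ {n : ℕ} (c : V H → Fin n) where

    colouringFamily : Family G n
    colouringFamily u v = subset (λ i → any? λ z →
      (φ z ≟ᶠ v) ×-dec ((c z ≟ᶠ i) ×-dec φN? z u))

    proper⇒separating : IsComplete H G φ → (∀ x y → Adj H x y → c x ≢ c y) →
      ∀ x → Separates colouringFamily x (c x)
    proper⇒separating complete proper x = (λ u u∈ _ → ∈-subset⁺ _ (x , refl , refl , u∈)) , outside
      where
      outside : ∀ w → φN x w → φ x < w → c x ∉ colouringFamily (φ x) w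
      outside w (y , xy , φy≡w) _ cx∈ with ∈-subset⁻ _ cx∈
      ... | z , φz≡w , cz≡cx , φx∈φNz =
        proper x z (complete x z (y , xy , trans φy≡w (≡-sym φz≡w)) φx∈φNz) (≡-sym cz≡cx)

proposition2p4 : (H G : Graph) (φ : V H → V G) → IsHom H G φ → IsComplete H G φ →
    (n : ℕ) → n ≥ 1 →
    Colourable H n ⇔ (∃[ A ] Independent H G φ n A)
proposition2p4 H G φ hom complete n _ = mk⇔ colouring⇒system system⇒colouring
  where
  colouring⇒system : Colourable H n → ∃[ A ] Independent H G φ n A
  colouring⇒system (c , proper) =
    A , separating⇒independent H G φ A (λ x → c x , proper⇒separating H G φ c complete proper x)
    where
    A : Family G n
    A = colouringFamily H G φ c

  system⇒colouring : ∃[ A ] Independent H G φ n A → Colourable H n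
  system⇒colouring (A , ind) =
    (λ x → proj₁ (separating x)) ,
    separating⇒proper H G φ A hom (λ x → proj₁ (separating x)) (λ x → proj₂ (separating x))
    where
    separating : ∀ x → ∃ (Separates H G φ A x)
    separating = independent⇒separating H G φ A hom ind
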